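{- For every $q\ge2$ (even or odd) and every $\ell,n\ge1$, in the set $A_q^n(0^\ell)$ listed in $\prec$ order, any two consecutive words differ in exactly one position, and the two symbols in this position differ by $1$ or $-1$.
   Context: $A_q=\{0,1,\dots,q-1\}$; $A_q^n$ is the set of length-$n$ words over $A_q$; $0^\ell$ is the word of $\ell$ zeros; $A_q^n(0^\ell)$ is the set of words of $A_q^n$ not containing $0^\ell$ as a factor (contiguous subword). For distinct words $\mathbf s,\mathbf t$ of equal length, with $k$ the leftmost differing position and $u=\sum_{i<k}s_i$, $\mathbf s\prec\mathbf t$ iff ($u$ even and $s_k<t_k$) or ($u$ odd and $s_k>t_k$). -}

module Defs where

open import Data.Nat using (ℕ; zero; suc; _+_; _<_; _%_)
open import Data.Product using (Σ; ∃; _×_; _,_)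
open import Data.Sum using (_⊎_)
open import Data.Fin using (Fin)
open import Data.List using (List; _++_; replicate)
open import Data.Vec using (Vec; []; _∷_; toList; lookup)
open import Data.Vec.Relation.Unary.All using (All)
open import Relation.Binary.PropositionalEquality using (_≡_; _≢_)
open import Relation.Nullary using (¬_)
open import Data.Empty using (⊥)

IsWord : (q n : ℕ) → Vec ℕ n → Set
IsWord q n w = All (_< q) w

Factor : List ℕ → List ℕ → Set
Factor u w = ∃ λ xs → ∃ λ ys → w ≡ xs ++ u ++ ys

InAvoid : (q ℓ n : ℕ) → Vec ℕ n → Set
InAvoid q ℓ n w = IsWord q n w × ¬ Factor (replicate ℓ 0) (toList w)

-- PrecAcc u s t : s ≺ t where u is the sum of the symbols of the common
-- prefix already read.
PrecAcc : {n : ℕ} → ℕ → Vec ℕ n → Vec ℕ n → Set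
PrecAcc u [] [] = ⊥
PrecAcc u (x ∷ s) (y ∷ t) =
  (x ≡ y × PrecAcc (u + x) s t)
  ⊎ (x ≢ y × ((u % 2 ≡ 0 × x < y) ⊎ (u % 2 ≡ 1 × y < x)))

_≺_ : {n : ℕ} → Vec ℕ n → Vec ℕ n → Set
s ≺ t = PrecAcc 0 s t

Consecutive : (q ℓ n : ℕ) → Vec ℕ n → Vec ℕ n → Set
Consecutive q ℓ n s t =
  InAvoid q ℓ n s × InAvoid q ℓ n t × s ≺ t
  × (∀ (w : Vec ℕ n) → InAvoid q ℓ n w → ¬ (s ≺ w × w ≺ t))

DifferByOneInOnePos : (n : ℕ) → Vec ℕ n → Vec ℕ n → Set
DifferByOneInOnePos n s t =
  Σ (Fin n) λ k →
    (∀ (i : Fin n) → i ≢ k → lookup s i ≡ lookup t i)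
    × (lookup s k + 1 ≡ lookup t k ⊎ lookup t k + 1 ≡ lookup s k)

module Submission where

-- Compare two consecutive words s ≺ t position by position.  While they
-- agree we move the common symbol into a "prefix" p and keep the parity u of
-- its symbol sum; so the claim is proved for words constrained only to
-- continue p without creating 0^ℓ.  At the first difference, say s = a x and
-- t = b y with u even and a < b (the odd case is its mirror image, since
-- raising the parity by one reverses ≺), some continuation of p would lie
-- strictly between s and t unless b = a + 1 and x = y: the candidates are
-- (a+1) 1…1, (a+1) x, a y, and 0 y, resp. 1 1…1 when a = 0.  Each candidate
-- avoids 0^ℓ because a run of zeros cannot straddle a nonzero symbol.

open import Defs
open import Data.Nat using (ℕ; zero; suc; _+_; _≤_; _<_; _%_; z≤n; s≤s; _≟_)
open import Data.Nat.Properties using (<-cmp; +-comm; +-suc; n<1+n; ≤∧≢⇒<; ≤-<-trans; <⇒≢)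
open import Data.Vec as Vec using (Vec; []; _∷_; toList; lookup)
open import Data.Vec.Relation.Unary.All using (All; []; _∷_; head; tail)
open import Data.List using (List; []; _∷_; _++_; replicate)
open import Data.List.Properties using (++-assoc; ∷-injective; ∷-injectiveˡ; ∷-injectiveʳ)
open import Data.Product using (∃; _×_; _,_; proj₁; proj₂; map₂)
open import Data.Sum using (_⊎_; inj₁; inj₂; [_,_]; map₁)
open import Data.Fin using (zero; suc)
open import Data.Empty using (⊥-elim)
open import Function using (_∘_)
open import Relation.Nullary using (¬_; yes; no)
open import Relation.Binary using (tri<; tri≈; tri>)
open import Relation.Binary.PropositionalEquality using (_≡_; _≢_; refl; sym; trans; cong; subst; ≢-sym; module ≡-Reasoning)

parity : ∀ v → v % 2 ≡ 0 ⊎ v % 2 ≡ 1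
parity zero = inj₁ refl
parity (suc zero) = inj₂ refl
parity (suc (suc v)) = parity v

even⇒suc-odd : ∀ v → v % 2 ≡ 0 → suc v % 2 ≡ 1
even⇒suc-odd zero _ = refl
even⇒suc-odd (suc zero) ()
even⇒suc-odd (suc (suc v)) e = even⇒suc-odd v e

odd⇒suc-even : ∀ v → v % 2 ≡ 1 → suc v % 2 ≡ 0
odd⇒suc-even zero ()
odd⇒suc-even (suc zero) _ = refl
odd⇒suc-even (suc (suc v)) o = odd⇒suc-even v o

suc-even⇒odd : ∀ v → suc v % 2 ≡ 0 → v % 2 ≡ 1
suc-even⇒odd zero ()
suc-even⇒odd (suc zero) _ = refl
suc-even⇒odd (suc (suc v)) e = suc-even⇒odd v e

suc-odd⇒even : ∀ v → suc v % 2 ≡ 1 → v % 2 ≡ 0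
suc-odd⇒even zero _ = refl
suc-odd⇒even (suc zero) ()
suc-odd⇒even (suc (suc v)) o = suc-odd⇒even v o

ascend-at-head : ∀ {n} {u a b} {x y : Vec ℕ n} →
                 u % 2 ≡ 0 → a < b → PrecAcc u (a ∷ x) (b ∷ y)
ascend-at-head ev a<b = inj₂ (<⇒≢ a<b , inj₁ (ev , a<b))

descend-at-head : ∀ {n} {u a b} {x y : Vec ℕ n} →
                  u % 2 ≡ 1 → b < a → PrecAcc u (a ∷ x) (b ∷ y)
descend-at-head od b<a = inj₂ (≢-sym (<⇒≢ b<a) , inj₂ (od , b<a))

same-head : ∀ {n} {u a} {x y : Vec ℕ n} → PrecAcc (u + a) x y → PrecAcc u (a ∷ x) (a ∷ y)
same-head x≺y = inj₁ (refl , x≺y)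

-- Changing the parity of the accumulated sum reverses the order; this is
-- what makes the odd case a mirror image of the even one.

PrecAcc-swap : ∀ {n} u (s t : Vec ℕ n) → PrecAcc u s t → PrecAcc (suc u) t s
PrecAcc-swap u [] [] ()
PrecAcc-swap u (a ∷ x) (.a ∷ y) (inj₁ (refl , x≺y)) = same-head (PrecAcc-swap (u + a) x y x≺y)
PrecAcc-swap u (a ∷ x) (b ∷ y) (inj₂ (_ , inj₁ (ev , a<b))) = descend-at-head (even⇒suc-odd u ev) a<b
PrecAcc-swap u (a ∷ x) (b ∷ y) (inj₂ (_ , inj₂ (od , b<a))) = ascend-at-head (odd⇒suc-even u od) b<a

PrecAcc-unswap : ∀ {n} u (s t : Vec ℕ n) → PrecAcc (suc u) s t → PrecAcc u t s
PrecAcc-unswap u [] [] ()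
PrecAcc-unswap u (a ∷ x) (.a ∷ y) (inj₁ (refl , x≺y)) = same-head (PrecAcc-unswap (u + a) x y x≺y)
PrecAcc-unswap u (a ∷ x) (b ∷ y) (inj₂ (_ , inj₁ (ev , a<b))) = descend-at-head (suc-even⇒odd u ev) a<b
PrecAcc-unswap u (a ∷ x) (b ∷ y) (inj₂ (_ , inj₂ (od , b<a))) = ascend-at-head (suc-odd⇒even u od) b<a

PrecAcc-trichotomy : ∀ {n} u (s t : Vec ℕ n) → s ≡ t ⊎ PrecAcc u s t ⊎ PrecAcc u t s
PrecAcc-trichotomy u [] [] = inj₁ refl
PrecAcc-trichotomy u (a ∷ x) (b ∷ y) with <-cmp a b | parity u
... | tri< a<b _ _ | inj₁ ev = inj₂ (inj₁ (ascend-at-head ev a<b))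
... | tri< a<b _ _ | inj₂ od = inj₂ (inj₂ (descend-at-head od a<b))
... | tri> _ _ b<a | inj₁ ev = inj₂ (inj₂ (ascend-at-head ev b<a))
... | tri> _ _ b<a | inj₂ od = inj₂ (inj₁ (descend-at-head od b<a))
... | tri≈ _ refl _ | _ with PrecAcc-trichotomy (u + a) x y
...   | inj₁ x≡y = inj₁ (cong (a ∷_) x≡y)
...   | inj₂ (inj₁ x≺y) = inj₂ (inj₁ (same-head x≺y))
...   | inj₂ (inj₂ y≺x) = inj₂ (inj₂ (same-head y≺x))

factor-++ˡ : ∀ (u L₁ L₂ : List ℕ) → Factor u L₁ → Factor u (L₁ ++ L₂)
factor-++ˡ u L₁ L₂ (xs , ys , e) = xs , ys ++ L₂ , (begin
    L₁ ++ L₂                ≡⟨ cong (_++ L₂) e ⟩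
    (xs ++ u ++ ys) ++ L₂   ≡⟨ ++-assoc xs (u ++ ys) L₂ ⟩
    xs ++ (u ++ ys) ++ L₂   ≡⟨ cong (xs ++_) (++-assoc u ys L₂) ⟩
    xs ++ u ++ ys ++ L₂     ∎)
  where open ≡-Reasoning

factor-++ʳ : ∀ (u L₁ L₂ : List ℕ) → Factor u L₂ → Factor u (L₁ ++ L₂)
factor-++ʳ u L₁ L₂ (xs , ys , e) = L₁ ++ xs , ys , trans (cong (L₁ ++_) e) (sym (++-assoc L₁ xs (u ++ ys)))

zero-run-prefix : ∀ m {c} L z ys → c ≢ 0 → L ++ c ∷ z ≡ replicate m 0 ++ ys →
                  ∃ λ zs → L ≡ replicate m 0 ++ zs
zero-run-prefix zero L z ys c≢0 e = L , refl
zero-run-prefix (suc m) [] z ys c≢0 e = ⊥-elim (c≢0 (∷-injectiveˡ e))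
zero-run-prefix (suc m) (a ∷ L) z ys c≢0 e with ∷-injective e
... | refl , e′ = map₂ (cong (0 ∷_)) (zero-run-prefix m L z ys c≢0 e′)

zero-run-split : ∀ m {c} L z → c ≢ 0 → Factor (replicate m 0) (L ++ c ∷ z) →
                 Factor (replicate m 0) L ⊎ Factor (replicate m 0) z
zero-run-split m L z c≢0 ([] , ys , e) with zero-run-prefix m L z ys c≢0 e
... | zs , L≡ = inj₁ ([] , zs , L≡)
zero-run-split m [] z c≢0 (x ∷ xs , ys , e) = inj₂ (xs , ys , ∷-injectiveʳ e)
zero-run-split m (a ∷ L) z c≢0 (x ∷ xs , ys , e) =
  map₁ (factor-++ʳ (replicate m 0) (a ∷ []) L) (zero-run-split m L z c≢0 (xs , ys , ∷-injectiveʳ e))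

nonempty-not-in-[] : ∀ {m} → 0 < m → ¬ Factor (replicate m 0) []
nonempty-not-in-[] {suc m} _ ([] , _ , ())
nonempty-not-in-[] {suc m} _ (_ ∷ _ , _ , ())

module ZeroRunFree (ℓ : ℕ) (0<ℓ : 0 < ℓ) where

  RunFree : List ℕ → Set
  RunFree w = ¬ Factor (replicate ℓ 0) w

  runFree-prefix : ∀ L₁ L₂ → RunFree (L₁ ++ L₂) → RunFree L₁
  runFree-prefix L₁ L₂ free f = free (factor-++ˡ (replicate ℓ 0) L₁ L₂ f)

  runFree-suffix : ∀ L₁ L₂ → RunFree (L₁ ++ L₂) → RunFree L₂
  runFree-suffix L₁ L₂ free f = free (factor-++ʳ (replicate ℓ 0) L₁ L₂ f)

  runFree-join : ∀ L {c} z → RunFree L → c ≢ 0 → RunFree z → RunFree (L ++ c ∷ z)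
  runFree-join L z freeL c≢0 freez = [ freeL , freez ] ∘ zero-run-split ℓ L z c≢0

  runFree-[] : RunFree []
  runFree-[] = nonempty-not-in-[] 0<ℓ

  runFree-ones : ∀ n → RunFree (toList (Vec.replicate n 1))
  runFree-ones zero = runFree-[]
  runFree-ones (suc n) = runFree-join [] _ runFree-[] (λ ()) (runFree-ones n)

differ-at-head : ∀ {n} a b (x : Vec ℕ n) → a + 1 ≡ b ⊎ b + 1 ≡ a →
                 DifferByOneInOnePos (suc n) (a ∷ x) (b ∷ x)
differ-at-head a b x ±1 = zero , agree-off-head , ±1
  where
  agree-off-head : ∀ i → i ≢ zero → lookup (a ∷ x) i ≡ lookup (b ∷ x) i
  agree-off-head zero i≢0 = ⊥-elim (i≢0 refl)
  agree-off-head (suc i) _ = refl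

differ-in-tail : ∀ {n} a (x y : Vec ℕ n) → DifferByOneInOnePos n x y →
                 DifferByOneInOnePos (suc n) (a ∷ x) (a ∷ y)
differ-in-tail a x y (k , agree , ±1) = suc k , agree-off-k , ±1
  where
  agree-off-k : ∀ i → i ≢ suc k → lookup (a ∷ x) i ≡ lookup (a ∷ y) i
  agree-off-k zero _ = refl
  agree-off-k (suc i) i≢k = agree i (i≢k ∘ cong suc)

module Consecutive-words (q ℓ : ℕ) (1<q : 1 < q) (0<ℓ : 0 < ℓ) where

  open ZeroRunFree ℓ 0<ℓ

  Continues : ∀ {n} → List ℕ → Vec ℕ n → Set
  Continues p w = All (_< q) w × RunFree (p ++ toList w)

  NoneBetween : ∀ {n} → ℕ → List ℕ → Vec ℕ n → Vec ℕ n → Set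
  NoneBetween {n} u p s t = ∀ (w : Vec ℕ n) → Continues p w → ¬ (PrecAcc u s w × PrecAcc u w t)

  continues-prefix : ∀ {n} p a (w : Vec ℕ n) → Continues p (a ∷ w) → RunFree p
  continues-prefix p a w (_ , free) = runFree-prefix p (a ∷ toList w) free

  continues-tail : ∀ {n} p a (w : Vec ℕ n) → Continues p (a ∷ w) → RunFree (toList w)
  continues-tail p a w (_ , free) = runFree-suffix (a ∷ []) (toList w) (runFree-suffix p (a ∷ toList w) free)

  continues-shift : ∀ {n} p a (w : Vec ℕ n) → Continues p (a ∷ w) → Continues (p ++ a ∷ []) w
  continues-shift p a w (a∷w<q , free) = tail a∷w<q , subst RunFree (sym (++-assoc p (a ∷ []) (toList w))) free

  continues-unshift : ∀ {n} p a (w : Vec ℕ n) → a < q → Continues (p ++ a ∷ []) w → Continues p (a ∷ w)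
  continues-unshift p a w a<q (w<q , free) = a<q ∷ w<q , subst RunFree (++-assoc p (a ∷ []) (toList w)) free

  continues-after-nonzero : ∀ {n} p c (w : Vec ℕ n) → RunFree p → c ≢ 0 → c < q →
                            All (_< q) w → RunFree (toList w) → Continues p (c ∷ w)
  continues-after-nonzero p c w freep c≢0 c<q w<q freew = c<q ∷ w<q , runFree-join p (toList w) freep c≢0 freew

  -- The words c 1…1 (c ≠ 0) are the all-purpose witnesses; they need q ≥ 2.
  ones<q : ∀ n → All (_< q) (Vec.replicate n 1)
  ones<q zero = []
  ones<q (suc n) = 1<q ∷ ones<q n

  continues-ones : ∀ {n} p c → RunFree p → c ≢ 0 → c < q → Continues p (c ∷ Vec.replicate n 1)
  continues-ones {n} p c freep c≢0 c<q =
    continues-after-nonzero p c _ freep c≢0 c<q (ones<q n) (runFree-ones n)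

  -- The heads are adjacent; otherwise (a+1) 1…1 lies between s and t.
  heads-adjacent : ∀ {n} u p a b (x y : Vec ℕ n) → u % 2 ≡ 0 → a < b →
                   Continues p (a ∷ x) → Continues p (b ∷ y) →
                   NoneBetween u p (a ∷ x) (b ∷ y) → suc a ≡ b
  heads-adjacent u p a b x y ev a<b cs ct none with suc a ≟ b
  ... | yes a+1≡b = a+1≡b
  ... | no a+1≢b = ⊥-elim (none (suc a ∷ Vec.replicate _ 1)
          (continues-ones p (suc a) (continues-prefix p a x cs) (λ ()) (≤-<-trans a<b (head (proj₁ ct))))
          (ascend-at-head ev (n<1+n a) , ascend-at-head ev (≤∧≢⇒< a<b a+1≢b)))

  -- The tail of t is not below that of s; otherwise (a+1) x lies between.
  tail-not-below : ∀ {n} u p a (x y : Vec ℕ n) → u % 2 ≡ 0 →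
                   Continues p (a ∷ x) → Continues p (suc a ∷ y) →
                   NoneBetween u p (a ∷ x) (suc a ∷ y) → ¬ PrecAcc (u + a) y x
  tail-not-below u p a x y ev cs ct none y≺x = none (suc a ∷ x)
    (continues-after-nonzero p (suc a) x (continues-prefix p a x cs) (λ ()) (head (proj₁ ct))
      (tail (proj₁ cs)) (continues-tail p a x cs))
    (ascend-at-head ev (n<1+n a) , same-head x≺y)
    where
    x≺y : PrecAcc (u + suc a) x y
    x≺y = subst (λ v → PrecAcc v x y) (sym (+-suc u a)) (PrecAcc-swap (u + a) y x y≺x)

  -- The tail of t is not above that of s either; the witness is a y if
  -- a ≠ 0, and otherwise 0 y or 1 1…1 depending on whether y starts with 0.
  tail-not-above : ∀ {n} u p a (x y : Vec ℕ n) → u % 2 ≡ 0 →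
                   Continues p (a ∷ x) → Continues p (suc a ∷ y) →
                   NoneBetween u p (a ∷ x) (suc a ∷ y) → ¬ PrecAcc (u + a) x y
  tail-not-above u p (suc a) x y ev cs ct none x≺y = none (suc a ∷ y)
    (continues-after-nonzero p (suc a) y (continues-prefix p _ x cs) (λ ()) (head (proj₁ cs))
      (tail (proj₁ ct)) (continues-tail p _ y ct))
    (same-head x≺y , ascend-at-head ev (n<1+n (suc a)))
  tail-not-above u p zero [] [] ev cs ct none ()
  tail-not-above {suc n} u p zero x (y₀ ∷ y) ev cs ct none x≺y with y₀ ≟ 0
  ... | no y₀≢0 = none (0 ∷ y₀ ∷ y)
          (continues-unshift p 0 (y₀ ∷ y) (head (proj₁ cs))
            (continues-after-nonzero (p ++ 0 ∷ []) y₀ y p0-free y₀≢0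
              (head (tail (proj₁ ct))) (tail (tail (proj₁ ct))) y-free))
          (same-head x≺y , ascend-at-head ev (s≤s z≤n))
    where
    p0-free : RunFree (p ++ 0 ∷ [])
    p0-free = runFree-prefix (p ++ 0 ∷ []) (toList x) (proj₂ (continues-shift p 0 x cs))
    y-free : RunFree (toList y)
    y-free = runFree-suffix (y₀ ∷ []) (toList y) (continues-tail p 1 (y₀ ∷ y) ct)
  ... | yes refl = none (1 ∷ Vec.replicate (suc n) 1)
          (continues-ones p 1 (continues-prefix p 0 x cs) (λ ()) 1<q)
          (ascend-at-head ev (s≤s z≤n) , same-head (descend-at-head u+1-odd (s≤s z≤n)))
    where
    u+1-odd : (u + 1) % 2 ≡ 1
    u+1-odd = subst (λ v → v % 2 ≡ 1) (sym (+-comm u 1)) (even⇒suc-odd u ev)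

  first-difference-ascending : ∀ {n} u p a b (x y : Vec ℕ n) → u % 2 ≡ 0 → a < b →
                               Continues p (a ∷ x) → Continues p (b ∷ y) →
                               NoneBetween u p (a ∷ x) (b ∷ y) → x ≡ y × a + 1 ≡ b
  first-difference-ascending u p a b x y ev a<b cs ct none
    with heads-adjacent u p a b x y ev a<b cs ct none
  ... | refl with PrecAcc-trichotomy (u + a) x y
  ...   | inj₁ x≡y = x≡y , +-comm a 1
  ...   | inj₂ (inj₁ x≺y) = ⊥-elim (tail-not-above u p a x y ev cs ct none x≺y)
  ...   | inj₂ (inj₂ y≺x) = ⊥-elim (tail-not-below u p a x y ev cs ct none y≺x)

  -- The descending case (odd parity, b < a) is the ascending one for the
  -- swapped pair t ≺ s with parity u + 1.
  first-difference-descending : ∀ {n} u p a b (x y : Vec ℕ n) → u % 2 ≡ 1 → b < a →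
                                Continues p (a ∷ x) → Continues p (b ∷ y) →
                                NoneBetween u p (a ∷ x) (b ∷ y) → y ≡ x × b + 1 ≡ a
  first-difference-descending u p a b x y od b<a cs ct none =
    first-difference-ascending (suc u) p b a y x (odd⇒suc-even u od) b<a ct cs
      λ w cw (t≺w , w≺s) → none w cw (PrecAcc-unswap u w (a ∷ x) w≺s , PrecAcc-unswap u (b ∷ y) w t≺w)

  consecutive-differ-by-one : ∀ {n} u p (s t : Vec ℕ n) → Continues p s → Continues p t →
                              PrecAcc u s t → NoneBetween u p s t → DifferByOneInOnePos n s t
  consecutive-differ-by-one u p [] [] cs ct () none
  consecutive-differ-by-one u p (a ∷ x) (.a ∷ y) cs ct (inj₁ (refl , x≺y)) none =
    differ-in-tail a x y (consecutive-differ-by-one (u + a) (p ++ a ∷ []) x y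
      (continues-shift p a x cs) (continues-shift p a y ct) x≺y
      λ w cw (x≺w , w≺y) → none (a ∷ w) (continues-unshift p a w (head (proj₁ cs)) cw) (same-head x≺w , same-head w≺y))
  consecutive-differ-by-one u p (a ∷ x) (b ∷ y) cs ct (inj₂ (_ , inj₁ (ev , a<b))) none
    with first-difference-ascending u p a b x y ev a<b cs ct none
  ... | refl , a+1≡b = differ-at-head a b x (inj₁ a+1≡b)
  consecutive-differ-by-one u p (a ∷ x) (b ∷ y) cs ct (inj₂ (_ , inj₂ (od , b<a))) none
    with first-difference-descending u p a b x y od b<a cs ct none
  ... | refl , b+1≡a = differ-at-head a b x (inj₂ b+1≡a)

proposition13 : (q ℓ n : ℕ) → 2 ≤ q → 1 ≤ ℓ → 1 ≤ n →
    (s t : Vec ℕ n) → Consecutive q ℓ n s t → DifferByOneInOnePos n s t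
proposition13 q ℓ n 1<q 0<ℓ _ s t (s∈ , t∈ , s≺t , none) =
  Consecutive-words.consecutive-differ-by-one q ℓ 1<q 0<ℓ 0 [] s t s∈ t∈ s≺t none
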